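{- Let $\mathcal{L}$ be a unimodal signature and $\mathbf{A}$ an $\mathcal{L}$-modal algebra. Then every relation $R^{\Delta}_{\alpha}$ ($\Delta_\alpha\in\mathcal{L}$) of the canonical frame of $\mathbf{A}$ is componentwise minimally generated (and hence minimally generated) as a subset of the product poset $P_{\Delta_\alpha}$.
   Context: Modal symbols: $\Box_{+},\Box_{ - },\Diamond_{+},\Diamond_{ - }$; a unimodal signature $\mathcal{L}$ is a subset of these. An $\mathcal{L}$-modal algebra is a bounded distributive lattice with one unary operation per symbol in $\mathcal{L}$ satisfying the applicable identities $\Box_{+}(a\wedge b)=\Box_{+}a\wedge\Box_{+}b$, $\Box_{+}\top=\top$; $\Box_{ - }(a\vee b)=\Box_{ - }a\wedge\Box_{ - }b$, $\Box_{ - }\bot=\top$; $\Diamond_{+}(a\vee b)=\Diamond_{+}a\vee\Diamond_{+}b$, $\Diamond_{+}\bot=\bot$; $\Diamond_{ - }(a\wedge b)=\Diamond_{ - }a\vee\Diamond_{ - }b$, $\Diamond_{ - }\top=\bot$. The canonical frame of $\mathbf{A}$ is the set $W$ of prime filters of $\mathbf{A}$ ordered by inclusion, with relations (for those symbols in $\mathcal{L}$): $\mathcal{U}R^{\Box}_{+}\mathcal{V}$ iff for all $a$, $\Box_{+}a\in\mathcal{U}$ implies $a\in\mathcal{V}$; $\mathcal{U}R^{\Box}_{ - }\mathcal{V}$ iff $\Box_{ - }a\in\mathcal{U}$ implies $a\notin\mathcal{V}$; $\mathcal{U}R^{\Diamond}_{+}\mathcal{V}$ iff $a\in\mathcal{V}$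 implies $\Diamond_{+}a\in\mathcal{U}$; $\mathcal{U}R^{\Diamond}_{ - }\mathcal{V}$ iff $a\notin\mathcal{V}$ implies $\Diamond_{ - }a\in\mathcal{U}$. With $\leq$ denoting inclusion, the product posets are $P_{\Box_{+}}=(W,\geq)\times(W,\leq)$, $P_{\Box_{ - }}=(W,\geq)\times(W,\geq)$, $P_{\Diamond_{+}}=(W,\leq)\times(W,\geq)$, $P_{\Diamond_{ - }}=(W,\leq)\times(W,\leq)$. If $P=(U,\preceq_1)\times(V,\preceq_2)$, a subset $X\subseteq U\times V$ is componentwise minimally generated if for each $(u,v)\in X$ both sets $\{w\in V:(u,w)\in X,\ w\preceq_2 v\}$ and $\{w\in U:(w,v)\in X,\ w\preceq_1 u\}$ have a minimal element (w.r.t. $\preceq_2$, resp. $\preceq_1$); it is minimally generated if for each $x\in X$ the set $\{y\in X:y\preceq x\}$ has a minimal element in the product order $\preceq$. -}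

module Defs where

open import Level using (Level; _⊔_; suc)
open import Data.Bool using (Bool; T)
open import Data.Product using (Σ; ∃; _×_; _,_; proj₁; proj₂)
open import Data.Sum using (_⊎_)
open import Relation.Nullary using (¬_)
open import Relation.Unary using (Pred)
open import Relation.Binary.Bundles using (Poset)
open import Algebra.Lattice.Bundles using (DistributiveLattice)

record BoundedDistributiveLattice (a ℓ : Level) : Set (suc (a ⊔ ℓ)) where
  field
    distributiveLattice : DistributiveLattice a ℓ
  open DistributiveLattice distributiveLattice public
  field
    ⊤ : Carrier
    ⊥ : Carrier
    ∧-identityʳ : ∀ x → (x ∧ ⊤) ≈ x
    ∨-identityʳ : ∀ x → (x ∨ ⊥) ≈ x

  _≤_ : Carrier → Carrier → Set ℓ
  x ≤ y = (x ∧ y) ≈ x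

data Symbol : Set where
  □₊ □₋ ◇₊ ◇₋ : Symbol

Signature : Set
Signature = Symbol → Bool

_∈ˢ_ : Symbol → Signature → Set
s ∈ˢ L = T (L s)

module _ {a ℓ : Level} (A : BoundedDistributiveLattice a ℓ) where
  open BoundedDistributiveLattice A

  ModalAxioms : Symbol → (Carrier → Carrier) → Set (a ⊔ ℓ)
  ModalAxioms □₊ f = (∀ x y → f (x ∧ y) ≈ (f x ∧ f y)) × (f ⊤ ≈ ⊤)
  ModalAxioms □₋ f = (∀ x y → f (x ∨ y) ≈ (f x ∧ f y)) × (f ⊥ ≈ ⊤)
  ModalAxioms ◇₊ f = (∀ x y → f (x ∨ y) ≈ (f x ∨ f y)) × (f ⊥ ≈ ⊥)
  ModalAxioms ◇₋ f = (∀ x y → f (x ∧ y) ≈ (f x ∨ f y)) × (f ⊤ ≈ ⊥)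

record ModalAlgebra (L : Signature) (a ℓ : Level) : Set (suc (a ⊔ ℓ)) where
  field
    bdl : BoundedDistributiveLattice a ℓ
  open BoundedDistributiveLattice bdl public
  field
    op     : (s : Symbol) → s ∈ˢ L → Carrier → Carrier
    op-cong : ∀ s (h : s ∈ˢ L) {x y} → x ≈ y → op s h x ≈ op s h y
    op-ax  : ∀ s (h : s ∈ˢ L) → ModalAxioms bdl s (op s h)

module _ {a ℓ : Level} (A : BoundedDistributiveLattice a ℓ) where
  open BoundedDistributiveLattice A

  record PrimeFilter : Set (suc (a ⊔ ℓ)) where
    field
      mem    : Pred Carrier (a ⊔ ℓ)
      top    : mem ⊤
      upward : ∀ {x y} → mem x → x ≤ y → mem y
      meet   : ∀ {x y} → mem x → mem y → mem (x ∧ y)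
      proper : ¬ mem ⊥
      prime  : ∀ {x y} → mem (x ∨ y) → mem x ⊎ mem y

  open PrimeFilter

  _⊆ᶠ_ : PrimeFilter → PrimeFilter → Set (a ⊔ ℓ)
  U ⊆ᶠ V = ∀ x → mem U x → mem V x

  _⊇ᶠ_ : PrimeFilter → PrimeFilter → Set (a ⊔ ℓ)
  U ⊇ᶠ V = V ⊆ᶠ U

module _ {L : Signature} {a ℓ : Level} (A : ModalAlgebra L a ℓ) where
  open ModalAlgebra A
  open PrimeFilter

  W : Set (suc (a ⊔ ℓ))
  W = PrimeFilter bdl

  CanRel : (s : Symbol) → s ∈ˢ L → W → W → Set (a ⊔ ℓ)
  CanRel □₊ h U V = ∀ x → mem U (op □₊ h x) → mem V x
  CanRel □₋ h U V = ∀ x → mem U (op □₋ h x) → ¬ mem V x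
  CanRel ◇₊ h U V = ∀ x → mem V x → mem U (op ◇₊ h x)
  CanRel ◇₋ h U V = ∀ x → ¬ mem V x → mem U (op ◇₋ h x)

  -- the product poset P_Δ = (W, ≼₁) × (W, ≼₂)
  ord₁ : Symbol → W → W → Set (a ⊔ ℓ)
  ord₁ □₊ = _⊇ᶠ_ bdl
  ord₁ □₋ = _⊇ᶠ_ bdl
  ord₁ ◇₊ = _⊆ᶠ_ bdl
  ord₁ ◇₋ = _⊆ᶠ_ bdl

  ord₂ : Symbol → W → W → Set (a ⊔ ℓ)
  ord₂ □₊ = _⊆ᶠ_ bdl
  ord₂ □₋ = _⊇ᶠ_ bdl
  ord₂ ◇₊ = _⊇ᶠ_ bdl
  ord₂ ◇₋ = _⊆ᶠ_ bdl

module _ {u r p : Level} {U : Set u} where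

  IsMinimal : (U → U → Set r) → Pred U p → U → Set (u ⊔ r ⊔ p)
  IsMinimal _≼_ S m = S m × (∀ y → S y → y ≼ m → m ≼ y)

  HasMinimal : (U → U → Set r) → Pred U p → Set (u ⊔ r ⊔ p)
  HasMinimal _≼_ S = ∃ λ m → IsMinimal _≼_ S m

module _ {u v r₁ r₂ p : Level} {U : Set u} {V : Set v}
         (_≼₁_ : U → U → Set r₁) (_≼₂_ : V → V → Set r₂) where

  ComponentwiseMinimallyGenerated : (U → V → Set p) → Set (u ⊔ v ⊔ r₁ ⊔ r₂ ⊔ p)
  ComponentwiseMinimallyGenerated X =
    ∀ x y → X x y →
      HasMinimal _≼₂_ (λ w → X x w × w ≼₂ y)
      × HasMinimal _≼₁_ (λ w → X w y × w ≼₁ x)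

  _≼×_ : U × V → U × V → Set (r₁ ⊔ r₂)
  (x , y) ≼× (x' , y') = (x ≼₁ x') × (y ≼₂ y')

  MinimallyGenerated : (U → V → Set p) → Set (u ⊔ v ⊔ r₁ ⊔ r₂ ⊔ p)
  MinimallyGenerated X =
    ∀ x y → X x y →
      HasMinimal _≼×_ (λ z → X (proj₁ z) (proj₂ z) × z ≼× (x , y))

module _ {c ℓ₁ ℓ₂ : Level} (P : Poset c ℓ₁ ℓ₂) where
  open Poset P

  IsChain : Pred Carrier c → Set (c ⊔ ℓ₂)
  IsChain C = ∀ x y → C x → C y → (x ≤ y) ⊎ (y ≤ x)

ZornsLemma : (c ℓ₁ ℓ₂ : Level) → Set (suc (c ⊔ ℓ₁ ⊔ ℓ₂))
ZornsLemma c ℓ₁ ℓ₂ =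
  (P : Poset c ℓ₁ ℓ₂) →
  let open Poset P in
  ((C : Pred Carrier c) → IsChain P C → ∃ λ b → ∀ x → C x → x ≤ b) →
  ∃ λ m → ∀ x → m ≤ x → x ≤ m

-- Under excluded middle, the union and the intersection of a nonempty chain of
-- prime filters are again prime filters. Each section R[U] = {V : U R V} and
-- R⁻¹[V] = {U : U R V} of a canonical relation is closed under one of these two
-- operations -- the one matching its order in P_Δ -- because the defining
-- condition only tests membership of single lattice elements. Zorn's lemma then
-- yields a minimal element of each section below a given point, which is
-- componentwise minimal generation. Since R is an up-set of P_Δ, minimising
-- first the second coordinate and then the first gives a minimal element in
-- the product order.
module Submission where

open import Defs
open import Level using (Level; _⊔_; suc; Lift; lift; lower)
open import Function using (flip)
open import Data.Product using (_×_; ∃; _,_; proj₁; proj₂)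
open import Data.Sum using (_⊎_; inj₁; inj₂; [_,_]′; swap)
open import Data.Empty using (⊥; ⊥-elim)
open import Relation.Nullary using (¬_)
open import Relation.Nullary.Decidable using (True; toSum; map′; toWitness; fromWitness; decidable-stable)
open import Relation.Unary using (Pred)
open import Relation.Binary.Core using (Rel)
open import Relation.Binary.Definitions using (Reflexive; Transitive)
open import Relation.Binary.Bundles using (Poset)
open import Relation.Binary.PropositionalEquality using (_≡_; refl)
open import Axiom.ExcludedMiddle using (ExcludedMiddle)

module Classical {ℓ : Level} (em : ExcludedMiddle (suc ℓ)) where

  em↓ : ExcludedMiddle ℓ
  em↓ = map′ lower lift em

  -- Propositional resizing: a proposition about the level-(suc ℓ) type of prime
  -- filters becomes a level-ℓ one through its Boolean truth value.
  Resize : Set (suc ℓ) → Set ℓ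
  Resize P = Lift ℓ (True (em {P}))

  resize : {P : Set (suc ℓ)} → P → Resize P
  resize p = lift (fromWitness p)

  unresize : {P : Set (suc ℓ)} → Resize P → P
  unresize r = toWitness (lower r)

  ¬∀⇒∃¬ : {T : Set (suc ℓ)} {P : T → Set (suc ℓ)} {Q : T → Set ℓ} →
          ¬ (∀ z → P z → Q z) → ∃ λ z → P z × ¬ Q z
  ¬∀⇒∃¬ ¬∀ = decidable-stable em λ ¬∃ →
    ¬∀ λ z Pz → decidable-stable em↓ λ ¬Qz → ¬∃ (z , Pz , ¬Qz)

Chain : {t r p : Level} {T : Set t} → Rel T r → Pred T p → Set (t ⊔ r ⊔ p)
Chain _≤_ C = ∀ x y → C x → C y → (x ≤ y) ⊎ (y ≤ x)

module _ {t r p : Level} {T : Set t} {_≤_ : Rel T r} {C : Pred T p} where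

  chain-flip : Chain _≤_ C → Chain (flip _≤_) C
  chain-flip C-chain x y x∈C y∈C = swap (C-chain x y x∈C y∈C)

  chain-adjoin-least : Reflexive _≤_ → Chain _≤_ C → ∀ y → (∀ z → C z → y ≤ z) →
                       Chain _≤_ (λ z → C z ⊎ z ≡ y)
  chain-adjoin-least ≤-refl C-chain y y≤C x z (inj₁ x∈C) (inj₁ z∈C) = C-chain x z x∈C z∈C
  chain-adjoin-least ≤-refl C-chain y y≤C x y (inj₁ x∈C) (inj₂ refl) = inj₂ (y≤C x x∈C)
  chain-adjoin-least ≤-refl C-chain y y≤C y z (inj₂ refl) (inj₁ z∈C) = inj₁ (y≤C z z∈C)
  chain-adjoin-least ≤-refl C-chain y y≤C y y (inj₂ refl) (inj₂ refl) = inj₁ ≤-refl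

-- Zorn's lemma for the Q-elements under the reversed order, quotiented by ⊑ ∩ ⊒.
zorn⇒hasMinimal : {ℓ : Level} → ZornsLemma (suc ℓ) ℓ ℓ →
  {T : Set (suc ℓ)} (_⊑_ : Rel T ℓ) → Reflexive _⊑_ → Transitive _⊑_ → (Q : Pred T ℓ) →
  ((C : Pred T (suc ℓ)) → (∀ w → C w → Q w) → Chain _⊑_ C → ∃ λ b → Q b × ∀ w → C w → b ⊑ w) →
  HasMinimal _⊑_ Q
zorn⇒hasMinimal zorn {T} _⊑_ ⊑-refl ⊑-trans Q bounded with zorn reversed chain-bounded
  where
  reversed : Poset _ _ _
  reversed = record
    { Carrier = ∃ Q
    ; _≈_ = λ p q → (proj₁ q ⊑ proj₁ p) × (proj₁ p ⊑ proj₁ q)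
    ; _≤_ = λ p q → proj₁ q ⊑ proj₁ p
    ; isPartialOrder = record
      { isPreorder = record
        { isEquivalence = record
          { refl = ⊑-refl , ⊑-refl
          ; sym = λ (q⊑p , p⊑q) → p⊑q , q⊑p
          ; trans = λ (q⊑p , p⊑q) (r⊑q , q⊑r) → ⊑-trans r⊑q q⊑p , ⊑-trans p⊑q q⊑r }
        ; reflexive = proj₁
        ; trans = λ q⊑p r⊑q → ⊑-trans r⊑q q⊑p }
      ; antisym = _,_ } }

  chain-bounded : (C : Pred (∃ Q) (suc _)) → IsChain reversed C →
                  ∃ λ b → ∀ x → C x → proj₁ b ⊑ proj₁ x
  chain-bounded C C-chain with bounded C′ (λ _ → proj₁) C′-chain
    where
    C′ : Pred T _
    C′ w = ∃ λ q → C (w , q)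
    C′-chain : Chain _⊑_ C′
    C′-chain w w′ (q , w∈C) (q′ , w′∈C) = swap (C-chain (w , q) (w′ , q′) w∈C w′∈C)
  ... | b , Qb , b⊑C′ = (b , Qb) , λ (w , q) w∈C → b⊑C′ w (q , w∈C)
... | (m , Qm) , m-maximal = m , Qm , λ y Qy y⊑m → m-maximal (y , Qy) y⊑m

componentwise⇒minimallyGenerated :
  {u v r₁ r₂ p : Level} {U : Set u} {V : Set v} {_≼₁_ : Rel U r₁} {_≼₂_ : Rel V r₂}
  {X : U → V → Set p} →
  Transitive _≼₁_ → Transitive _≼₂_ →
  (∀ {x x′ y} → X x y → x ≼₁ x′ → X x′ y) →
  (∀ {x y y′} → X x y → y ≼₂ y′ → X x y′) →
  ComponentwiseMinimallyGenerated _≼₁_ _≼₂_ X →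
  MinimallyGenerated _≼₁_ _≼₂_ X
componentwise⇒minimallyGenerated ≼₁-trans ≼₂-trans X-mono₁ X-mono₂ cmg x y Xxy
  with proj₁ (cmg x y Xxy)
... | v₀ , (Xxv₀ , v₀≼y) , v₀-minimal with proj₂ (cmg x v₀ Xxv₀)
... | u₀ , (Xu₀v₀ , u₀≼x) , u₀-minimal =
  (u₀ , v₀) , (Xu₀v₀ , u₀≼x , v₀≼y) ,
  λ (u , v) (Xuv , u≼x , v≼y) (u≼u₀ , v≼v₀) →
    u₀-minimal u (X-mono₂ Xuv v≼v₀ , ≼₁-trans u≼u₀ u₀≼x) u≼u₀ ,
    v₀-minimal v (X-mono₁ Xuv u≼x , ≼₂-trans v≼v₀ v₀≼y) v≼v₀

module PrimeFilters {a ℓ : Level} (em : ExcludedMiddle (suc (a ⊔ ℓ)))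
                    (A : BoundedDistributiveLattice a ℓ) where

  open Classical em
  open PrimeFilter

  ℓ′ : Level
  ℓ′ = a ⊔ ℓ

  _⊆_ : PrimeFilter A → PrimeFilter A → Set ℓ′
  _⊆_ = _⊆ᶠ_ A

  _⊇_ : PrimeFilter A → PrimeFilter A → Set ℓ′
  _⊇_ = _⊇ᶠ_ A

  ⊆-refl : Reflexive _⊆_
  ⊆-refl x x∈U = x∈U

  ⊆-trans : Transitive _⊆_
  ⊆-trans U⊆V V⊆W x x∈U = V⊆W x (U⊆V x x∈U)

  ⊇-refl : Reflexive _⊇_
  ⊇-refl {U} = ⊆-refl {U}

  ⊇-trans : Transitive _⊇_
  ⊇-trans {U} {V} {W} U⊇V V⊇W = ⊆-trans {W} {V} {U} V⊇W U⊇V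

  _⊆⋃_ : {p : Level} → PrimeFilter A → Pred (PrimeFilter A) p → Set (suc ℓ′ ⊔ p)
  B ⊆⋃ D = ∀ x → mem B x → ∃ λ z → D z × mem z x

  -- ⋂ D ⊆ B, in contrapositive form
  ⋂_⊆_ : {p : Level} → Pred (PrimeFilter A) p → PrimeFilter A → Set (suc ℓ′ ⊔ p)
  ⋂ D ⊆ B = ∀ x → ¬ mem B x → ∃ λ z → D z × ¬ mem z x

  ⊆⋃-mono : {p q : Level} {D : Pred (PrimeFilter A) p} {E : Pred (PrimeFilter A) q} →
            (∀ z → D z → E z) → ∀ {B} → B ⊆⋃ D → B ⊆⋃ E
  ⊆⋃-mono D⊆E B⊆⋃D x x∈B with B⊆⋃D x x∈B
  ... | z , z∈D , x∈z = z , D⊆E z z∈D , x∈z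

  ⋂⊆-mono : {p q : Level} {D : Pred (PrimeFilter A) p} {E : Pred (PrimeFilter A) q} →
            (∀ z → D z → E z) → ∀ {B} → ⋂ D ⊆ B → ⋂ E ⊆ B
  ⋂⊆-mono D⊆E ⋂D⊆B x x∉B with ⋂D⊆B x x∉B
  ... | z , z∈D , x∉z = z , D⊆E z z∈D , x∉z

  module ChainUnion (D : Pred (PrimeFilter A) (suc ℓ′)) (D-chain : Chain _⊆_ D)
                    (z₀ : PrimeFilter A) (z₀∈D : D z₀) where

    ⋃ᶜ : PrimeFilter A
    mem ⋃ᶜ x = Resize (∃ λ z → D z × mem z x)
    top ⋃ᶜ = resize (z₀ , z₀∈D , top z₀)
    upward ⋃ᶜ x∈⋃ x≤y with unresize x∈⋃
    ... | z , z∈D , x∈z = resize (z , z∈D , upward z x∈z x≤y)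
    meet ⋃ᶜ x∈⋃ y∈⋃ with unresize x∈⋃ | unresize y∈⋃
    ... | z , z∈D , x∈z | z′ , z′∈D , y∈z′ with D-chain z z′ z∈D z′∈D
    ...   | inj₁ z⊆z′ = resize (z′ , z′∈D , meet z′ (z⊆z′ _ x∈z) y∈z′)
    ...   | inj₂ z′⊆z = resize (z , z∈D , meet z x∈z (z′⊆z _ y∈z′))
    proper ⋃ᶜ ⊥∈⋃ with unresize ⊥∈⋃
    ... | z , _ , ⊥∈z = proper z ⊥∈z
    prime ⋃ᶜ x∨y∈⋃ with unresize x∨y∈⋃
    ... | z , z∈D , x∨y∈z with prime z x∨y∈z
    ...   | inj₁ x∈z = inj₁ (resize (z , z∈D , x∈z))
    ...   | inj₂ y∈z = inj₂ (resize (z , z∈D , y∈z))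

    ⊆-⋃ᶜ : ∀ z → D z → z ⊆ ⋃ᶜ
    ⊆-⋃ᶜ z z∈D x x∈z = resize (z , z∈D , x∈z)

    ⋃ᶜ-⊆⋃ : ⋃ᶜ ⊆⋃ D
    ⋃ᶜ-⊆⋃ x = unresize

  module ChainIntersection (D : Pred (PrimeFilter A) (suc ℓ′)) (D-chain : Chain _⊆_ D)
                           (z₀ : PrimeFilter A) (z₀∈D : D z₀) where

    ⋂ᶜ : PrimeFilter A
    mem ⋂ᶜ x = Resize (∀ z → D z → mem z x)
    top ⋂ᶜ = resize λ z _ → top z
    upward ⋂ᶜ x∈⋂ x≤y = resize λ z z∈D → upward z (unresize x∈⋂ z z∈D) x≤y
    meet ⋂ᶜ x∈⋂ y∈⋂ = resize λ z z∈D → meet z (unresize x∈⋂ z z∈D) (unresize y∈⋂ z z∈D)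
    proper ⋂ᶜ ⊥∈⋂ = proper z₀ (unresize ⊥∈⋂ z₀ z₀∈D)
    prime ⋂ᶜ {x} {y} x∨y∈⋂
      with toSum (em {∀ z → D z → mem z x}) | toSum (em {∀ z → D z → mem z y})
    ... | inj₁ x∈all | _ = inj₁ (resize x∈all)
    ... | inj₂ _ | inj₁ y∈all = inj₂ (resize y∈all)
    ... | inj₂ x∉all | inj₂ y∉all with ¬∀⇒∃¬ x∉all | ¬∀⇒∃¬ y∉all
    ...   | z , z∈D , x∉z | z′ , z′∈D , y∉z′ = ⊥-elim (neither (D-chain z z′ z∈D z′∈D))
      where
      x∨y∈ : ∀ w → D w → mem w x ⊎ mem w y
      x∨y∈ w w∈D = prime w (unresize x∨y∈⋂ w w∈D)
      -- the smaller of z, z′ contains neither x nor y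
      neither : (z ⊆ z′) ⊎ (z′ ⊆ z) → ⊥
      neither (inj₁ z⊆z′) = [ x∉z , (λ y∈z → y∉z′ (z⊆z′ y y∈z)) ]′ (x∨y∈ z z∈D)
      neither (inj₂ z′⊆z) = [ (λ x∈z′ → x∉z (z′⊆z x x∈z′)) , y∉z′ ]′ (x∨y∈ z′ z′∈D)

    ⋂ᶜ-⊆ : ∀ z → D z → ⋂ᶜ ⊆ z
    ⋂ᶜ-⊆ z z∈D x x∈⋂ = unresize x∈⋂ z z∈D

    ⋂-⊆⋂ᶜ : ⋂ D ⊆ ⋂ᶜ
    ⋂-⊆⋂ᶜ x x∉⋂ = ¬∀⇒∃¬ (λ x∈all → x∉⋂ (resize x∈all))

  -- Stronger than closure under unions (resp. intersections) of chains: R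
  -- contains every prime filter covered by R (resp. containing ⋂ R).
  ⋃-closed : Pred (PrimeFilter A) ℓ′ → Set (suc ℓ′)
  ⋃-closed R = ∀ B → B ⊆⋃ R → R B

  ⋂-closed : Pred (PrimeFilter A) ℓ′ → Set (suc ℓ′)
  ⋂-closed R = ∀ B → ⋂ R ⊆ B → R B

  module _ (zorn : ZornsLemma (suc ℓ′) ℓ′ ℓ′) (R : Pred (PrimeFilter A) ℓ′) where

    -- Adjoining y keeps the chain nonempty, also when C is empty.
    ⋃-closed⇒hasMinimal-above : ⋃-closed R → ∀ y → R y → HasMinimal _⊇_ (λ w → R w × y ⊆ w)
    ⋃-closed⇒hasMinimal-above R-closed y Ry =
      zorn⇒hasMinimal zorn _⊇_ (λ {U} → ⊇-refl {U}) (λ {U} {V} {W} → ⊇-trans {U} {V} {W})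
                      _ bounded
      where
      bounded : (C : Pred (PrimeFilter A) (suc ℓ′)) → (∀ w → C w → R w × y ⊆ w) →
                Chain _⊇_ C → ∃ λ b → (R b × y ⊆ b) × ∀ w → C w → b ⊇ w
      bounded C C⊆Q C-chain = ⋃ᶜ , (R-closed ⋃ᶜ (⊆⋃-mono D⊆R {⋃ᶜ} ⋃ᶜ-⊆⋃) , ⊆-⋃ᶜ y (inj₂ refl)) ,
                              λ w w∈C → ⊆-⋃ᶜ w (inj₁ w∈C)
        where
        D : Pred (PrimeFilter A) (suc ℓ′)
        D z = C z ⊎ z ≡ y
        D⊆R : ∀ z → D z → R z
        D⊆R z (inj₁ z∈C) = proj₁ (C⊆Q z z∈C)
        D⊆R z (inj₂ refl) = Ry
        D-chain : Chain _⊆_ D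
        D-chain = chain-adjoin-least (λ {U} → ⊆-refl {U}) (chain-flip C-chain) y
                                     (λ z z∈C → proj₂ (C⊆Q z z∈C))
        open ChainUnion D D-chain y (inj₂ refl)

    ⋂-closed⇒hasMinimal-below : ⋂-closed R → ∀ y → R y → HasMinimal _⊆_ (λ w → R w × w ⊆ y)
    ⋂-closed⇒hasMinimal-below R-closed y Ry =
      zorn⇒hasMinimal zorn _⊆_ (λ {U} → ⊆-refl {U}) (λ {U} {V} {W} → ⊆-trans {U} {V} {W})
                      _ bounded
      where
      bounded : (C : Pred (PrimeFilter A) (suc ℓ′)) → (∀ w → C w → R w × w ⊆ y) →
                Chain _⊆_ C → ∃ λ b → (R b × b ⊆ y) × ∀ w → C w → b ⊆ w
      bounded C C⊆Q C-chain = ⋂ᶜ , (R-closed ⋂ᶜ (⋂⊆-mono D⊆R {⋂ᶜ} ⋂-⊆⋂ᶜ) , ⋂ᶜ-⊆ y (inj₂ refl)) ,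
                              λ w w∈C → ⋂ᶜ-⊆ w (inj₁ w∈C)
        where
        D : Pred (PrimeFilter A) (suc ℓ′)
        D z = C z ⊎ z ≡ y
        D⊆R : ∀ z → D z → R z
        D⊆R z (inj₁ z∈C) = proj₁ (C⊆Q z z∈C)
        D⊆R z (inj₂ refl) = Ry
        D-chain : Chain _⊆_ D
        D-chain = chain-flip (chain-adjoin-least (λ {U} → ⊇-refl {U}) (chain-flip C-chain) y
                                                 (λ z z∈C → proj₂ (C⊆Q z z∈C)))
        open ChainIntersection D D-chain y (inj₂ refl)

module CanonicalFrame {a ℓ : Level} (em : ExcludedMiddle (suc (a ⊔ ℓ)))
                      (zorn : ZornsLemma (suc (a ⊔ ℓ)) (a ⊔ ℓ) (a ⊔ ℓ))
                      {L : Signature} (A : ModalAlgebra L a ℓ) where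

  open ModalAlgebra A using (bdl)
  open Classical em using (em↓)
  open PrimeFilters em bdl

  R : (s : Symbol) → s ∈ˢ L → W A → W A → Set ℓ′
  R = CanRel A

  □₊-successors-⋂-closed : ∀ h U → ⋂-closed (R □₊ h U)
  □₊-successors-⋂-closed h U B ⋂⊆B x □x∈U = decidable-stable em↓ λ x∉B →
    let z , URz , x∉z = ⋂⊆B x x∉B in x∉z (URz x □x∈U)

  □₊-predecessors-⋃-closed : ∀ h V → ⋃-closed (λ U → R □₊ h U V)
  □₊-predecessors-⋃-closed h V B B⊆⋃ x □x∈B =
    let z , zRV , □x∈z = B⊆⋃ _ □x∈B in zRV x □x∈z

  □₋-successors-⋃-closed : ∀ h U → ⋃-closed (R □₋ h U)
  □₋-successors-⋃-closed h U B B⊆⋃ x □x∈U x∈B =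
    let z , URz , x∈z = B⊆⋃ x x∈B in URz x □x∈U x∈z

  □₋-predecessors-⋃-closed : ∀ h V → ⋃-closed (λ U → R □₋ h U V)
  □₋-predecessors-⋃-closed h V B B⊆⋃ x □x∈B =
    let z , zRV , □x∈z = B⊆⋃ _ □x∈B in zRV x □x∈z

  ◇₊-successors-⋃-closed : ∀ h U → ⋃-closed (R ◇₊ h U)
  ◇₊-successors-⋃-closed h U B B⊆⋃ x x∈B =
    let z , URz , x∈z = B⊆⋃ x x∈B in URz x x∈z

  ◇₊-predecessors-⋂-closed : ∀ h V → ⋂-closed (λ U → R ◇₊ h U V)
  ◇₊-predecessors-⋂-closed h V B ⋂⊆B x x∈V = decidable-stable em↓ λ ◇x∉B →
    let z , zRV , ◇x∉z = ⋂⊆B _ ◇x∉B in ◇x∉z (zRV x x∈V)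

  ◇₋-successors-⋂-closed : ∀ h U → ⋂-closed (R ◇₋ h U)
  ◇₋-successors-⋂-closed h U B ⋂⊆B x x∉B =
    let z , URz , x∉z = ⋂⊆B x x∉B in URz x x∉z

  ◇₋-predecessors-⋂-closed : ∀ h V → ⋂-closed (λ U → R ◇₋ h U V)
  ◇₋-predecessors-⋂-closed h V B ⋂⊆B x x∉V = decidable-stable em↓ λ ◇x∉B →
    let z , zRV , ◇x∉z = ⋂⊆B _ ◇x∉B in ◇x∉z (zRV x x∉V)

  canRel-componentwiseMinimallyGenerated :
    ∀ s h → ComponentwiseMinimallyGenerated (ord₁ A s) (ord₂ A s) (R s h)
  canRel-componentwiseMinimallyGenerated □₊ h U V URV =
    ⋂-closed⇒hasMinimal-below zorn (R □₊ h U) (□₊-successors-⋂-closed h U) V URV ,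
    ⋃-closed⇒hasMinimal-above zorn (λ U′ → R □₊ h U′ V) (□₊-predecessors-⋃-closed h V) U URV
  canRel-componentwiseMinimallyGenerated □₋ h U V URV =
    ⋃-closed⇒hasMinimal-above zorn (R □₋ h U) (□₋-successors-⋃-closed h U) V URV ,
    ⋃-closed⇒hasMinimal-above zorn (λ U′ → R □₋ h U′ V) (□₋-predecessors-⋃-closed h V) U URV
  canRel-componentwiseMinimallyGenerated ◇₊ h U V URV =
    ⋃-closed⇒hasMinimal-above zorn (R ◇₊ h U) (◇₊-successors-⋃-closed h U) V URV ,
    ⋂-closed⇒hasMinimal-below zorn (λ U′ → R ◇₊ h U′ V) (◇₊-predecessors-⋂-closed h V) U URV
  canRel-componentwiseMinimallyGenerated ◇₋ h U V URV =
    ⋂-closed⇒hasMinimal-below zorn (R ◇₋ h U) (◇₋-successors-⋂-closed h U) V URV ,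
    ⋂-closed⇒hasMinimal-below zorn (λ U′ → R ◇₋ h U′ V) (◇₋-predecessors-⋂-closed h V) U URV

  ord₁-trans : ∀ s → Transitive (ord₁ A s)
  ord₁-trans □₊ {U} {V} {W} = ⊇-trans {U} {V} {W}
  ord₁-trans □₋ {U} {V} {W} = ⊇-trans {U} {V} {W}
  ord₁-trans ◇₊ {U} {V} {W} = ⊆-trans {U} {V} {W}
  ord₁-trans ◇₋ {U} {V} {W} = ⊆-trans {U} {V} {W}

  ord₂-trans : ∀ s → Transitive (ord₂ A s)
  ord₂-trans □₊ {U} {V} {W} = ⊆-trans {U} {V} {W}
  ord₂-trans □₋ {U} {V} {W} = ⊇-trans {U} {V} {W}
  ord₂-trans ◇₊ {U} {V} {W} = ⊇-trans {U} {V} {W}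
  ord₂-trans ◇₋ {U} {V} {W} = ⊆-trans {U} {V} {W}

  canRel-mono₁ : ∀ s h {U U′ V} → R s h U V → ord₁ A s U U′ → R s h U′ V
  canRel-mono₁ □₊ h URV U′⊆U x □x∈U′ = URV x (U′⊆U _ □x∈U′)
  canRel-mono₁ □₋ h URV U′⊆U x □x∈U′ = URV x (U′⊆U _ □x∈U′)
  canRel-mono₁ ◇₊ h URV U⊆U′ x x∈V = U⊆U′ _ (URV x x∈V)
  canRel-mono₁ ◇₋ h URV U⊆U′ x x∉V = U⊆U′ _ (URV x x∉V)

  canRel-mono₂ : ∀ s h {U V V′} → R s h U V → ord₂ A s V V′ → R s h U V′
  canRel-mono₂ □₊ h URV V⊆V′ x □x∈U = V⊆V′ x (URV x □x∈U)
  canRel-mono₂ □₋ h URV V′⊆V x □x∈U x∈V′ = URV x □x∈U (V′⊆V x x∈V′)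
  canRel-mono₂ ◇₊ h URV V′⊆V x x∈V′ = URV x (V′⊆V x x∈V′)
  canRel-mono₂ ◇₋ h URV V⊆V′ x x∉V′ = URV x (λ x∈V → x∉V′ (V⊆V′ x x∈V))

mainTheorem4 : {a ℓ : Level} →
    ExcludedMiddle (suc (a ⊔ ℓ)) →
    ZornsLemma (suc (a ⊔ ℓ)) (a ⊔ ℓ) (a ⊔ ℓ) →
    (L : Signature) (A : ModalAlgebra L a ℓ) (s : Symbol) (h : s ∈ˢ L) →
      ComponentwiseMinimallyGenerated (ord₁ A s) (ord₂ A s) (CanRel A s h)
      × MinimallyGenerated (ord₁ A s) (ord₂ A s) (CanRel A s h)
mainTheorem4 em zorn L A s h =
  cmg , componentwise⇒minimallyGenerated (ord₁-trans s) (ord₂-trans s)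
                                         (canRel-mono₁ s h) (canRel-mono₂ s h) cmg
  where
  open CanonicalFrame em zorn A
  cmg : ComponentwiseMinimallyGenerated (ord₁ A s) (ord₂ A s) (CanRel A s h)
  cmg = canRel-componentwiseMinimallyGenerated s h
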